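{- Let $G$ be a graph on $n \ge 1$ vertices with minimum degree $\delta$. Then $$\tilde{\alpha}(G) = n - \max_{1 \le s \le n} \min_{S \subseteq V(G),\, |S| = s} |N(S)| = n - \max_{1 \le s \le n-\delta} \min_{S \subseteq V(G),\, |S| = s} |N(S)|.$$
   Context: All graphs are finite and simple. For a vertex set $S$, $N(S)$ denotes the set of vertices not in $S$ that are adjacent to at least one vertex of $S$. For positive integers $s,t$, an $(s,t)$-bipartite-hole of $G$ is a pair of disjoint vertex sets $S,T$ with $|S|=s$, $|T|=t$ and no edge of $G$ between $S$ and $T$. The bipartite-hole-number $\tilde{\alpha}(G)$ is the minimum integer $k$ such that there exist positive integers $s,t$ with $s+t=k+1$ for which $G$ contains no $(s,t)$-bipartite-hole. -}

module Defs where

open import Data.Bool using (Bool; true; false; _∧_; _∨_; not)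
open import Data.Nat using (ℕ; zero; suc; _+_; _≤_; _<_)
open import Data.Fin using (Fin)
import Data.Fin as F
open import Data.Fin.Subset using (Subset; _∈_; _∉_; ∣_∣; _∩_; Empty)
open import Data.Vec using (tabulate)
open import Data.Product using (Σ; _×_; ∃; ∃-syntax)
open import Relation.Binary.PropositionalEquality using (_≡_)
open import Relation.Nullary using (¬_)

record Graph (n : ℕ) : Set where
  field
    adj    : Fin n → Fin n → Bool
    sym    : ∀ u v → adj u v ≡ adj v u
    irrefl : ∀ v → adj v v ≡ false
open Graph public

anyFin : ∀ {n} → (Fin n → Bool) → Bool
anyFin {zero}  f = false
anyFin {suc n} f = f F.zero ∨ anyFin (λ i → f (F.suc i))

inS : ∀ {n} → Subset n → Fin n → Bool
inS S v = Data.Vec.lookup S v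
  where import Data.Vec

N : ∀ {n} → Graph n → Subset n → Subset n
N G S = tabulate (λ v → not (inS S v) ∧ anyFin (λ u → inS S u ∧ adj G u v))

nbhd : ∀ {n} → Graph n → Fin n → Subset n
nbhd G v = tabulate (adj G v)

deg : ∀ {n} → Graph n → Fin n → ℕ
deg G v = ∣ nbhd G v ∣

IsMinDegree : ∀ {n} → Graph n → ℕ → Set
IsMinDegree G δ = (∃[ v ] deg G v ≡ δ) × (∀ v → δ ≤ deg G v)

BipartiteHole : ∀ {n} → Graph n → ℕ → ℕ → Set
BipartiteHole {n} G s t =
  Σ (Subset n) λ S → Σ (Subset n) λ T →
    Empty (S ∩ T) × ∣ S ∣ ≡ s × ∣ T ∣ ≡ t ×
    (∀ u v → u ∈ S → v ∈ T → adj G u v ≡ false)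

Witnesses : ∀ {n} → Graph n → ℕ → Set
Witnesses G k = ∃[ s ] ∃[ t ] (1 ≤ s × 1 ≤ t × s + t ≡ k + 1 × ¬ BipartiteHole G s t)

IsBipartiteHoleNumber : ∀ {n} → Graph n → ℕ → Set
IsBipartiteHoleNumber G k = Witnesses G k × (∀ k′ → k′ < k → ¬ Witnesses G k′)

IsMinNbhd : ∀ {n} → Graph n → ℕ → ℕ → Set
IsMinNbhd {n} G s m =
  (Σ (Subset n) λ S → ∣ S ∣ ≡ s × ∣ N G S ∣ ≡ m) ×
  (∀ (S : Subset n) → ∣ S ∣ ≡ s → m ≤ ∣ N G S ∣)

IsMaxMinNbhd : ∀ {n} → Graph n → ℕ → ℕ → Set
IsMaxMinNbhd G h M =
  (∃[ s ] (1 ≤ s × s ≤ h × IsMinNbhd G s M)) ×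
  (∀ s m → 1 ≤ s → s ≤ h → IsMinNbhd G s m → m ≤ M)

{-# OPTIONS --safe #-}
module Submission where

-- A bipartite hole (S, T) is exactly a choice of T inside the complement of the closed
-- neighbourhood S ∪ N(S), so with f(s) = min_{|S| = s} |N(S)| there is an (s,t)-hole iff
-- s + f(s) + t ≤ n.  Hence a split s + t = k + 1 without hole exists iff k ≥ n - f(s) for
-- some s, and the least such k is n - max_s f(s).  The range of s may be cut down to
-- s ≤ n - δ, since for larger s we get f(s) ≤ n - s < δ ≤ f(1) + 1.

open import Data.Bool using (Bool; true; false; _∧_; not)
open import Data.Bool.Properties using (∨-zeroʳ; ¬-not)
open import Data.Fin using (Fin)
import Data.Fin as F
open import Data.Fin.Subset
  using (Subset; _∈_; _∉_; ∣_∣; _∩_; _∪_; ∁; _⊆_; Empty; Nonempty; ⊤; ⊥; inside; outside)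
open import Data.Fin.Subset.Properties
  using ( drop-∷-⊆; in⊆in; out⊆; ⊥⊆; ⊆⊤; ∈⊤; _∈?_; ∣⊥∣≡0; ∣⊤∣≡n; ∣p∣≤n; ∣∁p∣≡n∸∣p∣
        ; p⊆q⇒∣p∣≤∣q∣; p⊂q⇒∣p∣<∣q∣; x∈∁p⇒x∉p; x∉p⇒x∈∁p; x∈p∩q⁺; x∈p∩q⁻; x∈p∪q⁺; x∈p∪q⁻
        ; anySubset?; nonempty?; Empty-unique)
open import Data.Nat using (ℕ; zero; suc; _+_; _∸_; _≤_; _<_; z≤n; s≤s; s≤s⁻¹; _≤?_; _≟_)
open import Data.Nat.Induction using (<-wellFounded)
open import Data.Nat.Properties
open import Algebra.Properties.CommutativeSemigroup +-commutativeSemigroup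
  using (xy∙z≈y∙xz; xy∙z≈xz∙y)
open import Data.Product using (Σ; _×_; _,_; proj₁; proj₂; ∃-syntax)
open import Data.Sum using (inj₁; inj₂; [_,_])
open import Data.Vec using ([]; _∷_; lookup; here)
open import Data.Vec.Properties using ([]=⇒lookup; lookup⇒[]=; lookup∘tabulate)
open import Defs hiding (sym)
open import Function using (_∘_; id)
open import Induction.WellFounded using (Acc; acc)
open import Relation.Binary.PropositionalEquality
  using (_≡_; refl; sym; trans; cong; cong₂; subst; module ≡-Reasoning)
open import Relation.Nullary using (¬_; yes; no; contradiction)
open import Relation.Nullary.Decidable using (_×-dec_)
open import Relation.Unary using (Decidable)

leastWitness : {P : ℕ → Set} → Decidable P → ∀ {m} → P m → ∃[ k ] P k × (∀ {j} → P j → k ≤ j)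
leastWitness {P} P? = go (<-wellFounded _)
  where
  go : ∀ {m} → Acc _<_ m → P m → ∃[ k ] P k × (∀ {j} → P j → k ≤ j)
  go {m} (acc rs) Pm with anyUpTo? P? m
  ... | yes (j , j<m , Pj) = go (rs j<m) Pj
  ... | no nothingBelow    = m , Pm , λ Pj → ≮⇒≥ (λ j<m → nothingBelow (_ , j<m , Pj))

argmax : (g : ℕ → ℕ) (h : ℕ) → ∃[ s ] s ≤ h × (∀ {s′} → s′ ≤ h → g s′ ≤ g s)
argmax g zero = 0 , z≤n , λ { z≤n → ≤-refl }
argmax g (suc h) with argmax g h
... | s , s≤h , max with g s ≤? g (suc h)
...   | yes gs≤ = suc h , ≤-refl , λ s′≤ →
          [ (λ s′<  → ≤-trans (max (m<1+n⇒m≤n s′<)) gs≤) , (λ { refl → ≤-refl }) ] (m≤n⇒m<n∨m≡n s′≤)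
...   | no gs≰  = s , m≤n⇒m≤1+n s≤h , λ s′≤ →
          [ (λ s′< → max (m<1+n⇒m≤n s′<)) , (λ { refl → <⇒≤ (≰⇒> gs≰) }) ] (m≤n⇒m<n∨m≡n s′≤)

argmax₁ : (g : ℕ → ℕ) (h : ℕ) → 1 ≤ h →
          ∃[ s ] 1 ≤ s × s ≤ h × (∀ {s′} → 1 ≤ s′ → s′ ≤ h → g s′ ≤ g s)
argmax₁ g (suc h) _ with argmax (g ∘ suc) h
... | s , s≤h , max = suc s , s≤s z≤n , s≤s s≤h , λ { (s≤s z≤n) s′≤ → max (s≤s⁻¹ s′≤) }

∣p∪q∣≡∣p∣+∣q∣ : ∀ {n} {p q : Subset n} → q ⊆ ∁ p → ∣ p ∪ q ∣ ≡ ∣ p ∣ + ∣ q ∣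
∣p∪q∣≡∣p∣+∣q∣ {p = []}          {[]}          _   = refl
∣p∪q∣≡∣p∣+∣q∣ {p = inside ∷ p}  {inside ∷ q}  q⊆ with () ← q⊆ here
∣p∪q∣≡∣p∣+∣q∣ {p = inside ∷ p}  {outside ∷ q} q⊆ = cong suc (∣p∪q∣≡∣p∣+∣q∣ (drop-∷-⊆ q⊆))
∣p∪q∣≡∣p∣+∣q∣ {p = outside ∷ p} {inside ∷ q}  q⊆ =
  trans (cong suc (∣p∪q∣≡∣p∣+∣q∣ (drop-∷-⊆ q⊆))) (sym (+-suc ∣ p ∣ ∣ q ∣))
∣p∪q∣≡∣p∣+∣q∣ {p = outside ∷ p} {outside ∷ q} q⊆ = ∣p∪q∣≡∣p∣+∣q∣ (drop-∷-⊆ q⊆)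

⊆-ofSize : ∀ {n t} (p : Subset n) → t ≤ ∣ p ∣ → ∃[ q ] q ⊆ p × ∣ q ∣ ≡ t
⊆-ofSize []            z≤n = [] , id , refl
⊆-ofSize {n} {zero} p _ = ⊥ , ⊥⊆ , ∣⊥∣≡0 n
⊆-ofSize {t = suc t} (inside ∷ p) (s≤s t≤) with ⊆-ofSize p t≤
... | q , q⊆p , ∣q∣≡t = inside ∷ q , in⊆in q⊆p , cong suc ∣q∣≡t
⊆-ofSize {t = suc t} (outside ∷ p) t≤ with ⊆-ofSize p t≤
... | q , q⊆p , ∣q∣≡t = outside ∷ q , out⊆ q⊆p , ∣q∣≡t

0<∣p∣⇒Nonempty : ∀ {n} {p : Subset n} → 0 < ∣ p ∣ → Nonempty p
0<∣p∣⇒Nonempty {n} {p} 0<∣p∣ with nonempty? p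
... | yes nonempty = nonempty
... | no  empty    = contradiction (trans (cong ∣_∣ (Empty-unique empty)) (∣⊥∣≡0 n)) (>⇒≢ 0<∣p∣)

anyFin⁺ : ∀ {n} (f : Fin n → Bool) i → f i ≡ true → anyFin f ≡ true
anyFin⁺ f F.zero    fi rewrite fi = refl
anyFin⁺ f (F.suc i) fi rewrite anyFin⁺ (f ∘ F.suc) i fi = ∨-zeroʳ (f F.zero)

anyFin⁻ : ∀ {n} (f : Fin n → Bool) → anyFin f ≡ true → ∃[ i ] f i ≡ true
anyFin⁻ {suc n} f any with f F.zero in f0
... | true  = F.zero , f0
... | false with anyFin⁻ (f ∘ F.suc) any
...   | i , fi = F.suc i , fi

∧-true⁻ : ∀ {a b} → a ∧ b ≡ true → a ≡ true × b ≡ true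
∧-true⁻ {true} {true} _ = refl , refl

module _ {n : ℕ} (G : Graph n) where

  closedNbhd : Subset n → Subset n
  closedNbhd S = S ∪ N G S

  ∈nbhd⁻ : ∀ {v w} → w ∈ nbhd G v → adj G v w ≡ true
  ∈nbhd⁻ {v} {w} w∈ = trans (sym (lookup∘tabulate (adj G v) w)) ([]=⇒lookup w∈)

  lookup-N : ∀ S w → lookup (N G S) w ≡ not (inS S w) ∧ anyFin (λ u → inS S u ∧ adj G u w)
  lookup-N S w = lookup∘tabulate _ w

  ∈N⁺ : ∀ {S u w} → w ∉ S → u ∈ S → adj G u w ≡ true → w ∈ N G S
  ∈N⁺ {S} {u} {w} w∉S u∈S uw = lookup⇒[]= w (N G S) (begin
    lookup (N G S) w                                    ≡⟨ lookup-N S w ⟩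
    not (inS S w) ∧ anyFin (λ x → inS S x ∧ adj G x w)  ≡⟨ cong₂ (λ a b → not a ∧ b) inS≡false anyAdj ⟩
    true                                                ∎)
    where
    open ≡-Reasoning
    inS≡false : inS S w ≡ false
    inS≡false = ¬-not (w∉S ∘ lookup⇒[]= w S)
    anyAdj : anyFin (λ x → inS S x ∧ adj G x w) ≡ true
    anyAdj = anyFin⁺ _ u (cong₂ _∧_ ([]=⇒lookup u∈S) uw)

  ∈N⁻ : ∀ {S w} → w ∈ N G S → w ∉ S × ∃[ u ] u ∈ S × adj G u w ≡ true
  ∈N⁻ {S} {w} w∈ with ∧-true⁻ (trans (sym (lookup-N S w)) ([]=⇒lookup w∈))
  ... | notInS , anyAdj with anyFin⁻ _ anyAdj
  ...   | u , uw with ∧-true⁻ {inS S u} uw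
  ...     | u∈S , adj≡ = w∉S , u , lookup⇒[]= u S u∈S , adj≡
    where
    w∉S : w ∉ S
    w∉S w∈S with () ← trans (sym notInS) (cong not ([]=⇒lookup w∈S))

  N⊆∁ : ∀ S → N G S ⊆ ∁ S
  N⊆∁ S = x∉p⇒x∈∁p ∘ proj₁ ∘ ∈N⁻

  ∣closedNbhd∣ : ∀ S → ∣ closedNbhd S ∣ ≡ ∣ S ∣ + ∣ N G S ∣
  ∣closedNbhd∣ S = ∣p∪q∣≡∣p∣+∣q∣ (N⊆∁ S)

  ∣S∣+∣NS∣≤n : ∀ S → ∣ S ∣ + ∣ N G S ∣ ≤ n
  ∣S∣+∣NS∣≤n S = subst (_≤ n) (∣closedNbhd∣ S) (∣p∣≤n (closedNbhd S))

  nbhd⊆closedNbhd : ∀ {S v} → v ∈ S → nbhd G v ⊆ closedNbhd S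
  nbhd⊆closedNbhd {S} v∈S {w} w∈ with w ∈? S
  ... | yes w∈S = x∈p∪q⁺ (inj₁ w∈S)
  ... | no  w∉S = x∈p∪q⁺ (inj₂ (∈N⁺ w∉S v∈S (∈nbhd⁻ w∈)))

  deg<n : ∀ v → deg G v < n
  deg<n v = subst (deg G v <_) (∣⊤∣≡n n) (p⊂q⇒∣p∣<∣q∣ (⊆⊤ , v , ∈⊤ , v∉nbhd))
    where
    v∉nbhd : v ∉ nbhd G v
    v∉nbhd v∈ with () ← trans (sym (irrefl G v)) (∈nbhd⁻ v∈)

  NoEdges : Subset n → Subset n → Set
  NoEdges S T = ∀ u v → u ∈ S → v ∈ T → adj G u v ≡ false

  hole⇒⊆∁closedNbhd : ∀ {S T} → Empty (S ∩ T) → NoEdges S T → T ⊆ ∁ (closedNbhd S)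
  hole⇒⊆∁closedNbhd {S} {T} disjoint noEdges {v} v∈T =
    x∉p⇒x∈∁p (λ v∈ → [ v∉S , v∉N ] (x∈p∪q⁻ S (N G S) v∈))
    where
    v∉S : v ∉ S
    v∉S v∈S = disjoint (v , x∈p∩q⁺ (v∈S , v∈T))
    v∉N : v ∉ N G S
    v∉N v∈N with ∈N⁻ v∈N
    ... | _ , u , u∈S , uv with () ← trans (sym uv) (noEdges u v u∈S v∈T)

  ⊆∁closedNbhd⇒hole : ∀ {S T} → T ⊆ ∁ (closedNbhd S) → Empty (S ∩ T) × NoEdges S T
  ⊆∁closedNbhd⇒hole {S} {T} T⊆ = disjoint , noEdges
    where
    outside-closedNbhd : ∀ {v} → v ∈ T → v ∉ closedNbhd S
    outside-closedNbhd = x∈∁p⇒x∉p ∘ T⊆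
    disjoint : Empty (S ∩ T)
    disjoint (v , v∈S∩T) with x∈p∩q⁻ S T v∈S∩T
    ... | v∈S , v∈T = outside-closedNbhd v∈T (x∈p∪q⁺ (inj₁ v∈S))
    noEdges : NoEdges S T
    noEdges u v u∈S v∈T = ¬-not λ uv →
      outside-closedNbhd v∈T (x∈p∪q⁺ (inj₂ (∈N⁺ (outside-closedNbhd v∈T ∘ x∈p∪q⁺ ∘ inj₁) u∈S uv)))

  -- For s > n there is no s-subset, and the value 0 is junk.
  minNbhd : (s : ℕ) → Σ ℕ λ m → s ≤ n → IsMinNbhd G s m
  minNbhd s with s ≤? n
  ... | no  s≰n = 0 , λ s≤n → contradiction s≤n s≰n
  ... | yes s≤n with ⊆-ofSize ⊤ (subst (s ≤_) (sym (∣⊤∣≡n n)) s≤n)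
  ...   | S₀ , _ , ∣S₀∣≡s with leastWitness P? (S₀ , ∣S₀∣≡s , refl)
    where
    P? : Decidable λ m → Σ (Subset n) λ S → ∣ S ∣ ≡ s × ∣ N G S ∣ ≡ m
    P? m = anySubset? λ S → (∣ S ∣ ≟ s) ×-dec (∣ N G S ∣ ≟ m)
  ...     | m , attained , least = m , λ _ → attained , λ S ∣S∣≡s → least (S , ∣S∣≡s , refl)

  IsMinNbhd-unique : ∀ {s m m′} → IsMinNbhd G s m → IsMinNbhd G s m′ → m ≡ m′
  IsMinNbhd-unique ((S , ∣S∣≡s , ∣NS∣≡m) , m≤) ((S′ , ∣S′∣≡s , ∣NS′∣≡m′) , m′≤) =
    ≤-antisym (subst (_ ≤_) ∣NS′∣≡m′ (m≤ S′ ∣S′∣≡s)) (subst (_ ≤_) ∣NS∣≡m (m′≤ S ∣S∣≡s))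

  IsMinNbhd⇒s+m≤n : ∀ {s m} → IsMinNbhd G s m → s + m ≤ n
  IsMinNbhd⇒s+m≤n ((S , refl , refl) , _) = ∣S∣+∣NS∣≤n S

  δ≤s+minNbhd : ∀ {δ s m} → IsMinDegree G δ → 1 ≤ s → IsMinNbhd G s m → δ ≤ s + m
  δ≤s+minNbhd (_ , δ≤deg) 1≤s ((S , refl , refl) , _) with 0<∣p∣⇒Nonempty {p = S} 1≤s
  ... | v , v∈S = ≤-trans (δ≤deg v)
    (subst (deg G v ≤_) (∣closedNbhd∣ S) (p⊆q⇒∣p∣≤∣q∣ (nbhd⊆closedNbhd v∈S)))

  bipartiteHole⇒s+m+t≤n : ∀ {s m t} → IsMinNbhd G s m → BipartiteHole G s t → s + m + t ≤ n
  bipartiteHole⇒s+m+t≤n {m = m} (_ , minimal) (S , T , disjoint , refl , refl , noEdges) = begin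
    ∣ S ∣ + m + ∣ T ∣             ≤⟨ +-monoˡ-≤ ∣ T ∣ (+-monoʳ-≤ ∣ S ∣ (minimal S refl)) ⟩
    ∣ S ∣ + ∣ N G S ∣ + ∣ T ∣      ≡⟨ cong (_+ ∣ T ∣) (∣closedNbhd∣ S) ⟨
    ∣ closedNbhd S ∣ + ∣ T ∣       ≡⟨ ∣p∪q∣≡∣p∣+∣q∣ (hole⇒⊆∁closedNbhd {S} {T} disjoint noEdges) ⟨
    ∣ closedNbhd S ∪ T ∣           ≤⟨ ∣p∣≤n (closedNbhd S ∪ T) ⟩
    n                              ∎
    where open ≤-Reasoning

  s+m+t≤n⇒bipartiteHole : ∀ {s m t} → IsMinNbhd G s m → s + m + t ≤ n → BipartiteHole G s t
  s+m+t≤n⇒bipartiteHole {t = t} ((S , refl , refl) , _) s+m+t≤n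
    with ⊆-ofSize (∁ (closedNbhd S)) t≤∣∁closedNbhd∣
    where
    t≤∣∁closedNbhd∣ : t ≤ ∣ ∁ (closedNbhd S) ∣
    t≤∣∁closedNbhd∣ =
      subst (t ≤_) (sym (trans (∣∁p∣≡n∸∣p∣ (closedNbhd S)) (cong (n ∸_) (∣closedNbhd∣ S))))
            (m+n≤o⇒m≤o∸n t (subst (_≤ n) (+-comm _ t) s+m+t≤n))
  ... | T , T⊆ , ∣T∣≡t with ⊆∁closedNbhd⇒hole {S} T⊆
  ...   | disjoint , noEdges = S , T , disjoint , refl , ∣T∣≡t , noEdges

  minNbhd≤minNbhd₁ : ∀ {δ s m m₁} → IsMinDegree G δ → n ∸ δ < s →
                     IsMinNbhd G s m → IsMinNbhd G 1 m₁ → m ≤ m₁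
  minNbhd≤minNbhd₁ {δ} {s} {m} {m₁} minDeg n∸δ<s min min₁ =
    s≤s⁻¹ (+-cancelʳ-≤ (n ∸ δ) (suc m) (suc m₁) (begin
      suc m + (n ∸ δ)    ≡⟨ +-suc m (n ∸ δ) ⟨
      m + suc (n ∸ δ)    ≤⟨ +-monoʳ-≤ m n∸δ<s ⟩
      m + s              ≡⟨ +-comm m s ⟩
      s + m              ≤⟨ IsMinNbhd⇒s+m≤n min ⟩
      n                  ≤⟨ m≤n+m∸n n δ ⟩
      δ + (n ∸ δ)        ≤⟨ +-monoˡ-≤ (n ∸ δ) (δ≤s+minNbhd minDeg ≤-refl min₁) ⟩
      suc m₁ + (n ∸ δ)   ∎))
    where open ≤-Reasoning

  maxMinNbhd-exists : ∀ {h} → 1 ≤ h → h ≤ n → ∃[ M ] IsMaxMinNbhd G h M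
  maxMinNbhd-exists {h} 1≤h h≤n with argmax₁ (proj₁ ∘ minNbhd) h 1≤h
  ... | s₀ , 1≤s₀ , s₀≤h , max =
    proj₁ (minNbhd s₀) , (s₀ , 1≤s₀ , s₀≤h , proj₂ (minNbhd s₀) (≤-trans s₀≤h h≤n)) , bounded
    where
    bounded : ∀ s m → 1 ≤ s → s ≤ h → IsMinNbhd G s m → m ≤ proj₁ (minNbhd s₀)
    bounded s m 1≤s s≤h min =
      subst (_≤ _) (IsMinNbhd-unique (proj₂ (minNbhd s) (≤-trans s≤h h≤n)) min) (max 1≤s s≤h)

  IsMaxMinNbhd-extend : ∀ {δ M} → IsMinDegree G δ → IsMaxMinNbhd G (n ∸ δ) M → IsMaxMinNbhd G n M
  IsMaxMinNbhd-extend {δ} {M} minDeg ((s₀ , 1≤s₀ , s₀≤n∸δ , min₀) , bounded) =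
    (s₀ , 1≤s₀ , ≤-trans s₀≤n∸δ (m∸n≤m n δ) , min₀) , bounded′
    where
    1≤n∸δ : 1 ≤ n ∸ δ
    1≤n∸δ = ≤-trans 1≤s₀ s₀≤n∸δ
    min₁ : IsMinNbhd G 1 (proj₁ (minNbhd 1))
    min₁ = proj₂ (minNbhd 1) (≤-trans 1≤n∸δ (m∸n≤m n δ))
    bounded′ : ∀ s m → 1 ≤ s → s ≤ n → IsMinNbhd G s m → m ≤ M
    bounded′ s m 1≤s s≤n min with s ≤? n ∸ δ
    ... | yes s≤n∸δ = bounded s m 1≤s s≤n∸δ min
    ... | no  s≰n∸δ = ≤-trans (minNbhd≤minNbhd₁ minDeg (≰⇒> s≰n∸δ) min min₁)
                              (bounded 1 _ ≤-refl 1≤n∸δ min₁)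

  IsMaxMinNbhd⇒IsBipartiteHoleNumber : ∀ {M} → IsMaxMinNbhd G n M →
                                       IsBipartiteHoleNumber G (n ∸ M)
  IsMaxMinNbhd⇒IsBipartiteHoleNumber {M} ((s₀ , 1≤s₀ , _ , min₀) , bounded) = witness , minimal
    where
    k : ℕ
    k = n ∸ M
    M≤n : M ≤ n
    M≤n = m+n≤o⇒n≤o s₀ (IsMinNbhd⇒s+m≤n min₀)
    s₀≤k : s₀ ≤ k
    s₀≤k = m+n≤o⇒m≤o∸n s₀ (IsMinNbhd⇒s+m≤n min₀)
    t₀ : ℕ
    t₀ = suc (k ∸ s₀)
    s₀+t₀≡k+1 : s₀ + t₀ ≡ k + 1
    s₀+t₀≡k+1 = begin
      s₀ + suc (k ∸ s₀)    ≡⟨ +-suc s₀ (k ∸ s₀) ⟩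
      suc (s₀ + (k ∸ s₀))  ≡⟨ cong suc (m+[n∸m]≡n s₀≤k) ⟩
      suc k                ≡⟨ +-comm 1 k ⟩
      k + 1                ∎
      where open ≡-Reasoning
    s₀+M+t₀≡1+n : s₀ + M + t₀ ≡ suc n
    s₀+M+t₀≡1+n = begin
      s₀ + M + t₀          ≡⟨ xy∙z≈y∙xz s₀ M t₀ ⟩
      M + (s₀ + t₀)        ≡⟨ cong (M +_) s₀+t₀≡k+1 ⟩
      M + (k + 1)          ≡⟨ +-assoc M k 1 ⟨
      M + k + 1            ≡⟨ cong (_+ 1) (m+[n∸m]≡n M≤n) ⟩
      n + 1                ≡⟨ +-comm n 1 ⟩
      suc n                ∎
      where open ≡-Reasoning
    witness : Witnesses G k
    witness = s₀ , t₀ , 1≤s₀ , s≤s z≤n , s₀+t₀≡k+1 , λ hole →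
      n≮n n (subst (_≤ n) s₀+M+t₀≡1+n (bipartiteHole⇒s+m+t≤n min₀ hole))
    minimal : ∀ k′ → k′ < k → ¬ Witnesses G k′
    minimal k′ k′<k (s , t , 1≤s , _ , s+t≡k′+1 , noHole) =
      noHole (s+m+t≤n⇒bipartiteHole min fits)
      where
      s+t≤k : s + t ≤ k
      s+t≤k = subst (_≤ k) (sym (trans s+t≡k′+1 (+-comm k′ 1))) k′<k
      s≤n : s ≤ n
      s≤n = ≤-trans (m≤m+n s t) (≤-trans s+t≤k (m∸n≤m n M))
      m : ℕ
      m = proj₁ (minNbhd s)
      min : IsMinNbhd G s m
      min = proj₂ (minNbhd s) s≤n
      fits : s + m + t ≤ n
      fits = begin
        s + m + t    ≡⟨ xy∙z≈xz∙y s m t ⟩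
        s + t + m    ≤⟨ +-mono-≤ s+t≤k (bounded s m 1≤s s≤n min) ⟩
        k + M        ≡⟨ m∸n+n≡m M≤n ⟩
        n            ∎
        where open ≤-Reasoning

-- The hypothesis 1 ≤ n is implied by IsMinDegree, whose witness is a vertex.
proposition1p8 : (n : ℕ) → 1 ≤ n → (G : Graph n) → (δ : ℕ) → IsMinDegree G δ →
    Σ ℕ λ k → Σ ℕ λ M₁ → Σ ℕ λ M₂ →
      IsBipartiteHoleNumber G k × IsMaxMinNbhd G n M₁ × IsMaxMinNbhd G (n ∸ δ) M₂ ×
      k ≡ n ∸ M₁ × k ≡ n ∸ M₂
proposition1p8 n _ G δ minDeg@((v , deg≡δ) , _)
  with maxMinNbhd-exists G (m<n⇒0<n∸m δ<n) (m∸n≤m n δ)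
  where
  δ<n : δ < n
  δ<n = subst (_< n) deg≡δ (deg<n G v)
... | M , maxₙ∸δ =
  n ∸ M , M , M , IsMaxMinNbhd⇒IsBipartiteHoleNumber G maxₙ , maxₙ , maxₙ∸δ , refl , refl
  where
  maxₙ : IsMaxMinNbhd G n M
  maxₙ = IsMaxMinNbhd-extend G minDeg maxₙ∸δ
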